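{- Given graphs $H$ and $T$, let $F^e = F_{T,H}^e$ be the $T$-covering of $H$ with $e_H$ copies of $T$ in which each copy of $T$ intersects $H$ in a single edge and is otherwise vertex-disjoint from the remaining $e_H-1$ copies. Then \[ \mathrm{ex}^*(n, T, F^e)=\mathrm{ex}(n,T,H) +o(n^{v_T}). \]
   Context: $\mathrm{ex}(n,T,H)$ is the maximum number of copies of $T$ in an $H$-free subgraph of $K_n$. A $T$-covering of $H$ is a minimal collection of pairwise edge-disjoint copies of $T$ whose union contains a copy of $H$. For a $T$-covering (or family of $T$-coverings) $\mathcal{F}$ of $H$, $\mathrm{ex}^*(n,T,\mathcal{F})$ is the maximum size of a collection of copies of $T$ in $K_n$ containing no sub-collection isomorphic to (a member of) $\mathcal{F}$. -}

module Defs where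

open import Data.Nat using (ℕ; _≤_)
open import Data.Fin as F using (Fin)
open import Data.Fin.Subset using (Subset; _∈_)
open import Data.Vec using (Vec; lookup)
open import Data.Bool using (Bool; true; false)
open import Data.List using (List; length)
open import Data.List.Membership.Propositional renaming (_∈_ to _∈ₗ_)
open import Data.List.Relation.Unary.Unique.Propositional using (Unique)
open import Data.List.Relation.Unary.All using (All)
open import Data.Product using (Σ; ∃; ∃-syntax; ∃₂; _×_; _,_)
open import Data.Sum using (_⊎_)
open import Relation.Nullary using (¬_)
open import Relation.Binary.PropositionalEquality using (_≡_)
open import Function.Definitions using (Injective)
open import Function.Bundles using (_⇔_)

record Graph (v : ℕ) : Set where
  field
    adj    : Fin v → Fin v → Bool
    sym    : ∀ i j → adj i j ≡ true → adj j i ≡ true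
    irrefl : ∀ i → adj i i ≡ false

Edge : ∀ {v} → Graph v → Fin v → Fin v → Set
Edge G i j = Graph.adj G i j ≡ true

-- A subgraph of K_n, given by its vertex set and its edge set
-- (as an adjacency matrix of subsets, so that equality is extensional).
record Sub (n : ℕ) : Set where
  constructor sub
  field
    verts : Subset n
    edges : Vec (Subset n) n

open Sub public

SEdge : ∀ {n} → Sub n → Fin n → Fin n → Set
SEdge c x y = y ∈ lookup (edges c) x

IsCopyOf : ∀ {vT n} → Graph vT → Sub n → Set
IsCopyOf {vT} {n} T c =
  Σ (Fin vT → Fin n) λ φ →
    Injective _≡_ _≡_ φ
    × (∀ x → (x ∈ verts c) ⇔ (∃[ a ] φ a ≡ x))
    × (∀ x y → SEdge c x y ⇔ (∃₂ λ a b → φ a ≡ x × φ b ≡ y × Edge T a b))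

IsCollection : ∀ {vT n} → Graph vT → List (Sub n) → Set
IsCollection T C = Unique C × All (IsCopyOf T) C

ContainsCopy : ∀ {vH n} → Graph vH → Graph n → Set
ContainsCopy {vH} {n} H G =
  Σ (Fin vH → Fin n) λ ψ →
    Injective _≡_ _≡_ ψ × (∀ a b → Edge H a b → Edge G (ψ a) (ψ b))

IsMax : (ℕ → Set) → ℕ → Set
IsMax P m = P m × (∀ k → P k → k ≤ m)

ExAdmissible : ∀ {vT vH} → ℕ → Graph vT → Graph vH → ℕ → Set
ExAdmissible n T H m =
  Σ (Graph n) λ G → ¬ ContainsCopy H G ×
    (∃[ C ] IsCollection T C
            × All (λ c → ∀ x y → SEdge c x y → Edge G x y) C
            × length C ≡ m)

IsEx : ∀ {vT vH} → ℕ → Graph vT → Graph vH → ℕ → Set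
IsEx n T H = IsMax (ExAdmissible n T H)

-- The collection C (of copies of T in K_n) contains a sub-collection isomorphic
-- to F^e_{T,H}: an embedding ψ of H into K_n and, for every edge uw of H (u < w),
-- a copy c u w ∈ C containing the edge ψ(u)ψ(w), meeting ψ(V(H)) only in
-- {ψ(u), ψ(w)}, and such that copies for distinct edges share no vertices
-- outside ψ(V(H)).
ContainsFe : ∀ {vT vH n} → Graph vT → Graph vH → List (Sub n) → Set
ContainsFe {vT} {vH} {n} T H C =
  Σ (Fin vH → Fin n) λ ψ → Injective _≡_ _≡_ ψ ×
  Σ (Fin vH → Fin vH → Sub n) λ c →
    (∀ u w → Edge H u w → u F.< w →
        (c u w ∈ₗ C)
        × SEdge (c u w) (ψ u) (ψ w)
        × (∀ a → ψ a ∈ verts (c u w) → a ≡ u ⊎ a ≡ w))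
    × (∀ u w u' w' → Edge H u w → u F.< w → Edge H u' w' → u' F.< w' →
        ¬ (u ≡ u' × w ≡ w') →
        ∀ x → x ∈ verts (c u w) → x ∈ verts (c u' w') → ∃[ a ] ψ a ≡ x)

ExStarAdmissible : ∀ {vT vH} → ℕ → Graph vT → Graph vH → ℕ → Set
ExStarAdmissible {vT} {vH} n T H m =
  Σ (List (Sub n)) λ C → IsCollection T C × ¬ ContainsFe T H C × length C ≡ m

-- IsExStar n T H m  :⇔  m = ex*(n, T, F^e_{T,H})
IsExStar : ∀ {vT vH} → ℕ → Graph vT → Graph vH → ℕ → Set
IsExStar n T H = IsMax (ExStarAdmissible n T H)

module Submission where

-- The inequality ex ≤ ex* is easy: the copies of T inside an H-free host graph
-- never contain an F^e, because the edges of H carried by such an F^e would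
-- form a copy of H in the host.
--
-- For ex* ≤ ex + O(n^(vT−1)) take an F^e-free collection C and blockers of
-- K = vH + vH·vH·vT vertices.  Call pq robust if every blocker is avoided
-- (outside {p, q}) by some copy of C through the edge pq, and let the host graph
-- consist of the pairs robust in both directions.
--   * The host is H-free: along a copy ψ of H, choose greedily for each edge of H
--     a copy of C through it avoiding ψ(V(H)) and all copies chosen before
--     (at most K vertices); the result is an F^e inside C.
--   * The copies lying inside the host are admissible for ex, so there are at most ex.
--   * A copy not inside the host contains a non-robust edge φa φb, so it meets a
--     fixed blocker of that edge in a third vertex φc.  Hence it is determined by
--     (c, a, b, the blocker slot, φ off c): at most vT³·K·n^(vT−1) of them.

open import Defs
open import Data.Nat using (ℕ; zero; suc; _≤_; _+_; _*_; _^_; _∸_; ∣_-_∣; z≤n)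
import Data.Nat.Properties as ℕ
open import Data.Nat.Solver using (module +-*-Solver)
open import Data.Fin as Fin
  using (Fin; zero; suc; punchIn; punchOut; combine; remQuot; splitAt; _↑ˡ_; _↑ʳ_; funToFin; finToFun)
import Data.Fin.Properties as FinP
open import Data.Fin.Subset using (_∈_; _⊆_; ⊥)
open import Data.Fin.Subset.Properties using (⊆-antisym; ∉⊥; _∈?_)
open import Data.Vec using (lookup; tabulate; replicate)
open import Data.Vec.Properties using (tabulate∘lookup; tabulate-cong)
open import Data.Bool as Bool using (true)
open import Data.Maybe using (Maybe; just; nothing)
open import Data.List as List using (List; []; _∷_; length; filter)
open import Data.List.Membership.Propositional using (find; lose) renaming (_∈_ to _∈ₗ_)
open import Data.List.Membership.Propositional.Properties using (∈-lookup; ∈-allFin; ∈-cartesianProduct⁺)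
open import Data.List.Relation.Unary.Any as Any using (Any; here; there)
open import Data.List.Relation.Unary.All as All using (All)
import Data.List.Relation.Unary.All.Properties as AllP
open import Data.List.Relation.Unary.AllPairs using (_∷_)
open import Data.List.Relation.Unary.Unique.Propositional using (Unique)
import Data.List.Relation.Unary.Unique.Propositional.Properties as UniqueP
open import Data.Product using (Σ; ∃; ∃-syntax; ∃₂; _×_; _,_; proj₁; proj₂; uncurry)
open import Data.Sum as Sum using (_⊎_; inj₁; inj₂; [_,_]′)
open import Data.Empty using (⊥-elim)
open import Function using (_∘_)
open import Function.Bundles using (Equivalence)
open import Function.Definitions using (Injective)
open import Relation.Nullary using (¬_; Dec; yes; no; does; ¬?)
open import Relation.Nullary.Decidable using (dec-true; dec-false; _×-dec_; _⊎-dec_; _→-dec_)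
open import Relation.Binary using (tri<; tri≈; tri>)
open import Relation.Binary.PropositionalEquality

open Equivalence using (to; from)

does-true : ∀ {P : Set} (P? : Dec P) → does P? ≡ true → P
does-true (yes p) _ = p
does-true (no _) ()

¬→⇒×¬ : ∀ {P Q : Set} → Dec P → ¬ (P → Q) → P × ¬ Q
¬→⇒×¬ (yes p) ¬p→q = p , λ q → ¬p→q (λ _ → q)
¬→⇒×¬ (no ¬p) ¬p→q = ⊥-elim (¬p→q (⊥-elim ∘ ¬p))

counterexample : ∀ {n} {P Q : Fin n → Set} → (∀ x → Dec (P x)) → (∀ x → Dec (Q x)) →
  ¬ (∀ x → P x → Q x) → ∃ λ x → P x × ¬ Q x
counterexample {n} P? Q? ¬∀ with FinP.¬∀⟶∃¬ n _ (λ x → P? x →-dec Q? x) ¬∀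
... | x , ¬P→Q = x , ¬→⇒×¬ (P? x) ¬P→Q

counterexample₂ : ∀ {n} {P Q : Fin n → Fin n → Set} → (∀ x y → Dec (P x y)) → (∀ x y → Dec (Q x y)) →
  ¬ (∀ x y → P x y → Q x y) → ∃₂ λ x y → P x y × ¬ Q x y
counterexample₂ {n} P? Q? ¬∀
  with FinP.¬∀⟶∃¬ n _ (λ x → FinP.all? (λ y → P? x y →-dec Q? x y)) ¬∀
... | x , ¬∀y with counterexample (P? x) (Q? x) ¬∀y
... | y , pq = x , y , pq

lookup-injective : ∀ {A : Set} {xs : List A} → Unique xs →
  ∀ i j → List.lookup xs i ≡ List.lookup xs j → i ≡ j
lookup-injective (_ ∷ _) zero zero _ = refl
lookup-injective (x∉xs ∷ _) zero (suc j) e = ⊥-elim (All.lookup x∉xs (∈-lookup j) e)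
lookup-injective (x∉xs ∷ _) (suc i) zero e = ⊥-elim (All.lookup x∉xs (∈-lookup i) (sym e))
lookup-injective (_ ∷ u) (suc i) (suc j) e = cong suc (lookup-injective u i j e)

length-≤-by-injection : ∀ {A : Set} {P : A → Set} {N} {xs : List A}
  (code : ∀ {x} → P x → Fin N) → (∀ {x y} (px : P x) (py : P y) → code px ≡ code py → x ≡ y) →
  Unique xs → All P xs → length xs ≤ N
length-≤-by-injection {N = N} {xs} code code-injective distinct all-P with length xs ℕ.≤? N
... | yes ≤N = ≤N
... | no ≰N with FinP.pigeonhole (ℕ.≰⇒> ≰N) (λ i → code (All.lookup all-P (∈-lookup i)))
... | i , j , i<j , same =
  ⊥-elim (FinP.<⇒≢ i<j (lookup-injective distinct i j (code-injective _ _ same)))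

length-filter-split : ∀ {A : Set} {P : A → Set} (P? : ∀ x → Dec (P x)) (xs : List A) →
  length xs ≡ length (filter P? xs) + length (filter (¬? ∘ P?) xs)
length-filter-split P? [] = refl
length-filter-split P? (x ∷ xs) with P? x
... | yes _ = cong suc (length-filter-split P? xs)
... | no _ = trans (cong suc (length-filter-split P? xs)) (sym (ℕ.+-suc _ _))

funToFin-injective : ∀ {m n} {f g : Fin m → Fin n} → funToFin f ≡ funToFin g → ∀ i → f i ≡ g i
funToFin-injective {f = f} {g} same i = begin
  f i                       ≡⟨ FinP.finToFun-funToFin f i ⟨
  finToFun (funToFin f) i   ≡⟨ cong (λ k → finToFun k i) same ⟩
  finToFun (funToFin g) i   ≡⟨ FinP.finToFun-funToFin g i ⟩
  g i                       ∎
  where open ≡-Reasoning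

agree-off-punch : ∀ {A : Set} {m} {f g : Fin (suc m) → A} (c : Fin (suc m)) →
  (∀ i → f (punchIn c i) ≡ g (punchIn c i)) → ∀ x → c ≢ x → f x ≡ g x
agree-off-punch {f = f} {g} c agree x c≢x =
  subst (λ y → f y ≡ g y) (FinP.punchIn-punchOut c≢x) (agree (punchOut c≢x))

agree-everywhere : ∀ {A : Set} {m} {f g : Fin m → A} (c : Fin m) →
  (∀ x → c ≢ x → f x ≡ g x) → f c ≡ g c → ∀ x → f x ≡ g x
agree-everywhere c off-c at-c x with c Fin.≟ x
... | yes refl = at-c
... | no c≢x = off-c x c≢x

copy-⊆ : ∀ {vT n} {T : Graph vT} {c c' : Sub n} (cp : IsCopyOf T c) (cp' : IsCopyOf T c') →
  (∀ a → proj₁ cp a ≡ proj₁ cp' a) →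
  verts c ⊆ verts c' × (∀ x → lookup (edges c) x ⊆ lookup (edges c') x)
copy-⊆ (φ , _ , V , E) (φ' , _ , V' , E') same =
  (λ {x} x∈c → let a , φa≡x = to (V x) x∈c in from (V' x) (a , trans (sym (same a)) φa≡x)) ,
  (λ x {y} xy∈c → let a , b , φa≡x , φb≡y , ab = to (E x y) xy∈c in
     from (E' x y) (a , b , trans (sym (same a)) φa≡x , trans (sym (same b)) φb≡y , ab))

copy-determined : ∀ {vT n} {T : Graph vT} {c c' : Sub n} (cp : IsCopyOf T c) (cp' : IsCopyOf T c') →
  (∀ a → proj₁ cp a ≡ proj₁ cp' a) → c ≡ c'
copy-determined {T = T} {c = sub V E} {sub V' E'} cp cp' same =
  cong₂ sub (⊆-antisym (proj₁ c⊆c') (proj₁ c'⊆c))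
    (trans (sym (tabulate∘lookup E))
      (trans (tabulate-cong (λ x → ⊆-antisym (proj₂ c⊆c' x) (proj₂ c'⊆c x))) (tabulate∘lookup E')))
  where
  c⊆c' : V ⊆ V' × (∀ x → lookup E x ⊆ lookup E' x)
  c⊆c' = copy-⊆ {T = T} {c = sub V E} {sub V' E'} cp cp' same
  c'⊆c : V' ⊆ V × (∀ x → lookup E' x ⊆ lookup E x)
  c'⊆c = copy-⊆ {T = T} {c = sub V' E'} {sub V E} cp' cp (sym ∘ same)

-- ex ≤ ex*: the copies of T inside an H-free host contain no F^e, since the edges
-- ψ(u)ψ(w) of its copies would embed H into the host.
ex-admissible⇒ex*-admissible : ∀ {vT vH n m} (T : Graph vT) (H : Graph vH) →
  ExAdmissible n T H m → ExStarAdmissible n T H m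
ex-admissible⇒ex*-admissible T H (G , H-free , C , collection , inside-G , length≡) =
  C , collection , F^e-free , length≡
  where
  F^e-free : ¬ ContainsFe T H C
  F^e-free (ψ , ψ-injective , c , through , _) = H-free (ψ , ψ-injective , embed)
    where
    forward : ∀ u w → Edge H u w → u Fin.< w → Edge G (ψ u) (ψ w)
    forward u w uw u<w = let c∈C , uw∈c , _ = through u w uw u<w in All.lookup inside-G c∈C (ψ u) (ψ w) uw∈c
    embed : ∀ u w → Edge H u w → Edge G (ψ u) (ψ w)
    embed u w uw with FinP.<-cmp u w
    ... | tri< u<w _ _ = forward u w uw u<w
    ... | tri≈ _ refl _ with trans (sym uw) (Graph.irrefl H u)
    ...   | ()
    embed u w uw | tri> _ _ w<u = Graph.sym G _ _ (forward w u (Graph.sym H u w uw) w<u)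

-- Blockers have K = vH + vH·vH·vT vertices: room for ψ(V(H)) and one copy of T per pair of vertices of H.
blockerSize : ℕ → ℕ → ℕ
blockerSize vT vH = vH + vH * (vH * vT)

-- The number of codes (c, a, b, blocker slot, φ off c) of a copy of T.
badCodes : ℕ → ℕ → ℕ → ℕ
badCodes n K zero = 0
badCodes n K (suc m) = suc m * (suc m * (suc m * (K * n ^ m)))

encodeWith : ∀ {vT n K} (φ : Fin vT → Fin n) (a b c : Fin vT) (slot : Fin K) → Fin (badCodes n K vT)
encodeWith {suc _} φ a b c slot = combine c (combine a (combine b (combine slot (funToFin (φ ∘ punchIn c)))))

encodeWith-injective : ∀ {vT n K} {φ φ' : Fin vT → Fin n} {a b c a' b' c' slot slot'} →
  encodeWith {K = K} φ a b c slot ≡ encodeWith φ' a' b' c' slot' →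
  a ≡ a' × b ≡ b' × c ≡ c' × slot ≡ slot' × (∀ x → c ≢ x → φ x ≡ φ' x)
encodeWith-injective {suc _} {a = a} {b} {c} {a'} {b'} {c'} {slot} {slot'} same
  with refl , same₁ ← FinP.combine-injective c _ c' _ same
  with refl , same₂ ← FinP.combine-injective a _ a' _ same₁
  with refl , same₃ ← FinP.combine-injective b _ b' _ same₂
  with refl , same₄ ← FinP.combine-injective slot _ slot' _ same₃ =
  refl , refl , refl , refl , agree-off-punch c (funToFin-injective same₄)

badCodes-small : ∀ n K vT k → k * (vT * (vT * (vT * K))) ≤ n → k * badCodes n K vT ≤ n ^ vT
badCodes-small n K zero k _ rewrite ℕ.*-zeroʳ k = z≤n
badCodes-small n K (suc m) k large = begin
  k * (t * (t * (t * (K * n ^ m))))   ≡⟨ rearrange k t K (n ^ m) ⟩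
  k * (t * (t * (t * K))) * n ^ m     ≤⟨ ℕ.*-monoˡ-≤ (n ^ m) large ⟩
  n * n ^ m                           ∎
  where
  open ℕ.≤-Reasoning
  t : ℕ
  t = suc m
  rearrange : ∀ k t K z → k * (t * (t * (t * (K * z)))) ≡ k * (t * (t * (t * K))) * z
  rearrange = +-*-Solver.solve 4
    (λ k t K z → k :* (t :* (t :* (t :* (K :* z)))) := k :* (t :* (t :* (t :* K))) :* z) refl
    where open +-*-Solver

module HostGraph {vT vH n : ℕ} (T : Graph vT) (H : Graph vH)
                 (C : List (Sub n)) (copies : All (IsCopyOf T) C) where

  K : ℕ
  K = blockerSize vT vH

  Blocker : Set
  Blocker = Fin K → Fin n

  opaque
    sedge? : ∀ (c : Sub n) x y → Dec (SEdge c x y)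
    sedge? c x y = y ∈? lookup (edges c) x

  Avoids : Blocker → Fin n → Fin n → Sub n → Set
  Avoids F p q c = ∀ i → F i ∈ verts c → F i ≡ p ⊎ F i ≡ q

  opaque
    avoids? : ∀ F p q c → Dec (Avoids F p q c)
    avoids? F p q c = FinP.all? (λ i → (F i ∈? verts c) →-dec ((F i Fin.≟ p) ⊎-dec (F i Fin.≟ q)))

  avoids-cong : ∀ {F F' p q c} → (∀ i → F i ≡ F' i) → Avoids F p q c → Avoids F' p q c
  avoids-cong {c = c} F≗F' avoids i F'i∈c with avoids i (subst (_∈ verts c) (sym (F≗F' i)) F'i∈c)
  ... | inj₁ Fi≡p = inj₁ (trans (sym (F≗F' i)) Fi≡p)
  ... | inj₂ Fi≡q = inj₂ (trans (sym (F≗F' i)) Fi≡q)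

  Escapes : Blocker → Fin n → Fin n → Set
  Escapes F p q = Any (λ c → SEdge c p q × Avoids F p q c) C

  opaque
    escapes? : ∀ F p q → Dec (Escapes F p q)
    escapes? F p q = Any.any? (λ c → sedge? c p q ×-dec avoids? F p q c) C

  -- pq is robust if every blocker is escaped; blockers are quantified through
  -- their codes in Fin (n ^ K) so that robustness is decidable.
  Robust : Fin n → Fin n → Set
  Robust p q = ∀ (k : Fin (n ^ K)) → Escapes (finToFun k) p q

  opaque
    robust? : ∀ p q → Dec (Robust p q)
    robust? p q = FinP.all? (λ k → escapes? (finToFun k) p q)

  robust-escapes : ∀ {p q} → Robust p q → ∀ F → Escapes F p q
  robust-escapes {p} {q} robust F =
    Any.map (λ {c} (pq∈c , avoids) → pq∈c , avoids-cong {p = p} {q} {c} (FinP.finToFun-funToFin F) avoids)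
      (robust (funToFin F))

  blocker : Fin n → Fin n → Blocker
  blocker p q with robust? p q
  ... | yes _ = λ _ → p
  ... | no ¬robust = finToFun (proj₁ (FinP.¬∀⟶∃¬ _ _ (λ k → escapes? (finToFun k) p q) ¬robust))

  blocker-blocks : ∀ {p q} → ¬ Robust p q → ¬ Escapes (blocker p q) p q
  blocker-blocks {p} {q} ¬robust with robust? p q
  ... | yes robust = ⊥-elim (¬robust robust)
  ... | no ¬robust' = proj₂ (FinP.¬∀⟶∃¬ _ _ (λ k → escapes? (finToFun k) p q) ¬robust')

  RobustEdge : Fin n → Fin n → Set
  RobustEdge p q = Robust p q × Robust q p × p ≢ q

  opaque
    robustEdge? : ∀ p q → Dec (RobustEdge p q)
    robustEdge? p q = robust? p q ×-dec (robust? q p ×-dec ¬? (p Fin.≟ q))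

  host : Graph n
  host = record
    { adj = λ p q → does (robustEdge? p q)
    ; sym = λ p q pq → let pq-robust , qp-robust , p≢q = does-true (robustEdge? p q) pq in
              dec-true (robustEdge? q p) (qp-robust , pq-robust , p≢q ∘ sym)
    ; irrefl = λ p → dec-false (robustEdge? p p) (λ (_ , _ , p≢p) → p≢p refl)
    }

  edge⇒robust : ∀ {p q} → Edge host p q → Robust p q
  edge⇒robust {p} {q} pq = proj₁ (does-true (robustEdge? p q) pq)

  non-edge⇒non-robust : ∀ p q → ¬ Edge host p q → p ≢ q → ¬ Robust p q ⊎ ¬ Robust q p
  non-edge⇒non-robust p q ¬pq p≢q with robust? p q | robust? q p
  ... | yes pq | yes qp = ⊥-elim (¬pq (dec-true (robustEdge? p q) (pq , qp , p≢q)))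
  ... | no ¬pq-robust | _ = inj₁ ¬pq-robust
  ... | yes _ | no ¬qp-robust = inj₂ ¬qp-robust

  module Greedy (ψ : Fin vH → Fin n) (ψ-injective : Injective _≡_ _≡_ ψ)
                (robust : ∀ u w → Edge H u w → Robust (ψ u) (ψ w)) where

    Choice : Set
    Choice = Maybe (Σ (Sub n) (_∈ₗ C))

    State : Set
    State = Fin vH → Fin vH → Choice

    chosen : Choice → Sub n
    chosen nothing = sub ⊥ (replicate n ⊥)
    chosen (just (c , _)) = c

    -- The vertices of the chosen copy listed through its embedding (an empty
    -- slot (u, w) is padded with ψ u, which the blocker contains anyway).
    slotVertex : Choice → Fin vH → Fin vT → Fin n
    slotVertex nothing u _ = ψ u
    slotVertex (just (c , c∈C)) _ = proj₁ (All.lookup copies c∈C)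

    slotVertex-covers : ∀ o u x → x ∈ verts (chosen o) → ∃ λ t → slotVertex o u t ≡ x
    slotVertex-covers nothing u x x∈⊥ = ⊥-elim (∉⊥ x∈⊥)
    slotVertex-covers (just (c , c∈C)) u x x∈c = to (proj₁ (proj₂ (proj₂ (All.lookup copies c∈C))) x) x∈c

    stateBlocker : State → Blocker
    stateBlocker s = [ ψ , slotVertices ]′ ∘ splitAt vH
      where
      slotVertices : Fin (vH * (vH * vT)) → Fin n
      slotVertices = uncurry (λ u → uncurry (λ w → slotVertex (s u w) u) ∘ remQuot vT) ∘ remQuot (vH * vT)

    stateBlocker-ψ : ∀ s a → stateBlocker s (a ↑ˡ vH * (vH * vT)) ≡ ψ a
    stateBlocker-ψ s a rewrite FinP.splitAt-↑ˡ vH a (vH * (vH * vT)) = refl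

    stateBlocker-slot : ∀ s u w t → stateBlocker s (vH ↑ʳ combine u (combine w t)) ≡ slotVertex (s u w) u t
    stateBlocker-slot s u w t
      rewrite FinP.splitAt-↑ʳ vH (vH * (vH * vT)) (combine u (combine w t)) =
      trans (cong (uncurry (λ u' → uncurry (λ w' → slotVertex (s u' w') u') ∘ remQuot vT))
                  (FinP.remQuot-combine u (combine w t)))
            (cong (uncurry (λ w' → slotVertex (s u w') u)) (FinP.remQuot-combine w t))

    avoider-meets-ψ : ∀ s u w {c} → Avoids (stateBlocker s) (ψ u) (ψ w) c →
      ∀ a → ψ a ∈ verts c → a ≡ u ⊎ a ≡ w
    avoider-meets-ψ s u w {c} avoids a ψa∈c =
      Sum.map (ψ-injective ∘ trans (sym ψa≡)) (ψ-injective ∘ trans (sym ψa≡))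
        (avoids (a ↑ˡ _) (subst (_∈ verts c) (sym ψa≡) ψa∈c))
      where
      ψa≡ : stateBlocker s (a ↑ˡ vH * (vH * vT)) ≡ ψ a
      ψa≡ = stateBlocker-ψ s a

    avoider-meets-slots : ∀ s u w {c} → Avoids (stateBlocker s) (ψ u) (ψ w) c →
      ∀ u' w' x → x ∈ verts c → x ∈ verts (chosen (s u' w')) → ∃[ a ] ψ a ≡ x
    avoider-meets-slots s u w {c} avoids u' w' x x∈c x∈slot
      with slotVertex-covers (s u' w') u' x x∈slot
    ... | t , refl =
      [ (λ ≡ψu → u , sym (trans (sym slot≡) ≡ψu)) , (λ ≡ψw → w , sym (trans (sym slot≡) ≡ψw)) ]′
        (avoids i (subst (_∈ verts c) (sym slot≡) x∈c))
      where
      i : Fin K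
      i = vH ↑ʳ combine u' (combine w' t)
      slot≡ : stateBlocker s i ≡ slotVertex (s u' w') u' t
      slot≡ = stateBlocker-slot s u' w' t

    Escape : State → Fin vH → Fin vH → Set
    Escape s u w = Σ (Sub n) λ c → c ∈ₗ C × SEdge c (ψ u) (ψ w) × Avoids (stateBlocker s) (ψ u) (ψ w) c

    escape : ∀ s u w → Edge H u w → Escape s u w
    escape s u w uw = find (robust-escapes (robust u w uw) (stateBlocker s))

    assign : State → Fin vH → Fin vH → Choice → State
    assign s u w o u' w' with (u' Fin.≟ u) ×-dec (w' Fin.≟ w)
    ... | yes _ = o
    ... | no _ = s u' w'

    extend : ∀ s u w → Escape s u w → State
    extend s u w (c , c∈C , _) = assign s u w (just (c , c∈C))

    extend-verts : ∀ s u w (e : Escape s u w) u' w' x → x ∈ verts (chosen (extend s u w e u' w')) →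
      (u' ≡ u × w' ≡ w × x ∈ verts (proj₁ e)) ⊎ (¬ (u' ≡ u × w' ≡ w) × x ∈ verts (chosen (s u' w')))
    extend-verts s u w (c , _) u' w' x x∈ with (u' Fin.≟ u) ×-dec (w' Fin.≟ w)
    ... | yes (u'≡u , w'≡w) = inj₁ (u'≡u , w'≡w , x∈)
    ... | no different = inj₂ (different , x∈)

    step : Fin vH × Fin vH → State → State
    step (u , w) s with Graph.adj H u w Bool.≟ true
    ... | yes uw = extend s u w (escape s u w uw)
    ... | no _ = s

    run : List (Fin vH × Fin vH) → State
    run = List.foldr step (λ _ _ → nothing)

    SettledChoice : Choice → Fin vH → Fin vH → Set
    SettledChoice o u w = chosen o ∈ₗ C × SEdge (chosen o) (ψ u) (ψ w)
                          × (∀ a → ψ a ∈ verts (chosen o) → a ≡ u ⊎ a ≡ w)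

    Settled : State → Fin vH → Fin vH → Set
    Settled s u w = SettledChoice (s u w) u w

    Separated : State → Set
    Separated s = ∀ u w u' w' → ¬ (u ≡ u' × w ≡ w') →
      ∀ x → x ∈ verts (chosen (s u w)) → x ∈ verts (chosen (s u' w')) → ∃[ a ] ψ a ≡ x

    extend-settled : ∀ s u w (e : Escape s u w) → Settled (extend s u w e) u w
    extend-settled s u w (c , c∈C , uw∈c , avoids) with (u Fin.≟ u) ×-dec (w Fin.≟ w)
    ... | yes _ = c∈C , uw∈c , avoider-meets-ψ s u w {c} avoids
    ... | no different = ⊥-elim (different (refl , refl))

    extend-keeps-settled : ∀ s u w (e : Escape s u w) u' w' → Settled s u' w' → Settled (extend s u w e) u' w'
    extend-keeps-settled s u w (c , c∈C , uw∈c , avoids) u' w' settled with (u' Fin.≟ u) ×-dec (w' Fin.≟ w)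
    ... | yes (refl , refl) = c∈C , uw∈c , avoider-meets-ψ s u w {c} avoids
    ... | no _ = settled

    -- The new copy avoids all earlier ones outside ψ(V(H)), so separation persists.
    extend-separated : ∀ s u w (e : Escape s u w) → Separated s → Separated (extend s u w e)
    extend-separated s u w e@(c , _ , _ , avoids) separated u₁ w₁ u₂ w₂ distinct x x∈₁ x∈₂
      with extend-verts s u w e u₁ w₁ x x∈₁ | extend-verts s u w e u₂ w₂ x x∈₂
    ... | inj₁ (refl , refl , _) | inj₁ (refl , refl , _) = ⊥-elim (distinct (refl , refl))
    ... | inj₁ (_ , _ , x∈c) | inj₂ (_ , x∈old) = avoider-meets-slots s u w {c} avoids u₂ w₂ x x∈c x∈old
    ... | inj₂ (_ , x∈old) | inj₁ (_ , _ , x∈c) = avoider-meets-slots s u w {c} avoids u₁ w₁ x x∈c x∈old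
    ... | inj₂ (_ , x∈old₁) | inj₂ (_ , x∈old₂) = separated u₁ w₁ u₂ w₂ distinct x x∈old₁ x∈old₂

    run-separated : ∀ P → Separated (run P)
    run-separated [] _ _ _ _ _ x x∈⊥ _ = ⊥-elim (∉⊥ x∈⊥)
    run-separated ((u , w) ∷ P) with Graph.adj H u w Bool.≟ true
    ... | yes uw = extend-separated (run P) u w (escape (run P) u w uw) (run-separated P)
    ... | no _ = run-separated P

    run-settled : ∀ P u w → Edge H u w → (u , w) ∈ₗ P → Settled (run P) u w
    run-settled ((u , w) ∷ P) _ _ uw (here refl) with Graph.adj H u w Bool.≟ true
    ... | yes uw' = extend-settled (run P) u w (escape (run P) u w uw')
    ... | no ¬uw = ⊥-elim (¬uw uw)
    run-settled ((u , w) ∷ P) u' w' u'w' (there later) with Graph.adj H u w Bool.≟ true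
    ... | no _ = run-settled P u' w' u'w' later
    ... | yes uw = extend-keeps-settled (run P) u w (escape (run P) u w uw) u' w' (run-settled P u' w' u'w' later)

    allPairs : List (Fin vH × Fin vH)
    allPairs = List.cartesianProduct (List.allFin vH) (List.allFin vH)

    F^e-in-C : ContainsFe T H C
    F^e-in-C =
      ψ , ψ-injective , (λ u w → chosen (run allPairs u w)) ,
      (λ u w uw _ → run-settled allPairs u w uw (∈-cartesianProduct⁺ (∈-allFin u) (∈-allFin w))) ,
      (λ u w u' w' _ _ _ _ → run-separated allPairs u w u' w')

  host-H-free : ¬ ContainsFe T H C → ¬ ContainsCopy H host
  host-H-free F^e-free (ψ , ψ-injective , embed) =
    F^e-free (Greedy.F^e-in-C ψ ψ-injective (λ u w uw → edge⇒robust (embed u w uw)))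

  InHost : Sub n → Set
  InHost c = ∀ x y → SEdge c x y → Edge host x y

  opaque
    inHost? : ∀ c → Dec (InHost c)
    inHost? c = FinP.all? (λ x → FinP.all? (λ y → sedge? c x y →-dec (Graph.adj host x y Bool.≟ true)))

  record BadWitness (φ : Fin vT → Fin n) : Set where
    constructor witness
    field
      a b c : Fin vT
      c≢a : c ≢ a
      c≢b : c ≢ b
      slot : Fin K
      blocked : blocker (φ a) (φ b) slot ≡ φ c

  encode : ∀ {φ} → BadWitness φ → Fin (badCodes n K vT)
  encode {φ} (witness a b c _ _ slot _) = encodeWith φ a b c slot

  -- The code determines the embedding: off c it is stored, and φ c is read off the blocker.
  encode-injective : ∀ {φ φ'} (w : BadWitness φ) (w' : BadWitness φ') → encode w ≡ encode w' → ∀ x → φ x ≡ φ' x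
  encode-injective {φ} {φ'} (witness a b c c≢a c≢b slot blocked) (witness a' b' c' _ _ slot' blocked') same
    with refl , refl , refl , refl , off-c ←
      encodeWith-injective {φ = φ} {φ'} {a} {b} {c} {a'} {b'} {c'} {slot} {slot'} same =
    agree-everywhere c off-c at-c
    where
    open ≡-Reasoning
    at-c : φ c ≡ φ' c
    at-c = begin
      φ c                          ≡⟨ blocked ⟨
      blocker (φ a) (φ b) slot     ≡⟨ cong₂ (λ p q → blocker p q slot) (off-c a c≢a) (off-c b c≢b) ⟩
      blocker (φ' a) (φ' b) slot   ≡⟨ blocked' ⟩
      φ' c                         ∎

  irreflexive : ∀ {a b} → Edge T a b → a ≢ b
  irreflexive {a} ab refl with trans (sym ab) (Graph.irrefl T a)
  ... | ()

  blocked-witness : ∀ {c} → c ∈ₗ C → (cp : IsCopyOf T c) → ∀ a b → Edge T a b →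
    ¬ Robust (proj₁ cp a) (proj₁ cp b) → BadWitness (proj₁ cp)
  blocked-witness {c} c∈C (φ , _ , V , E) a b ab ¬robust
    with counterexample (λ i → F i ∈? verts c) (λ i → (F i Fin.≟ φ a) ⊎-dec (F i Fin.≟ φ b))
           (λ avoids → blocker-blocks ¬robust (lose c∈C (φaφb∈c , avoids)))
    where
    F : Blocker
    F = blocker (φ a) (φ b)
    φaφb∈c : SEdge c (φ a) (φ b)
    φaφb∈c = from (E (φ a) (φ b)) (a , b , refl , refl , ab)
  ... | slot , Fslot∈c , ¬a∨b with to (V (blocker (φ a) (φ b) slot)) Fslot∈c
  ... | c' , φc'≡ = witness a b c'
    (λ { refl → ¬a∨b (inj₁ (sym φc'≡)) }) (λ { refl → ¬a∨b (inj₂ (sym φc'≡)) }) slot (sym φc'≡)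

  bad-witness : ∀ {c} → c ∈ₗ C → (cp : IsCopyOf T c) → ¬ InHost c → BadWitness (proj₁ cp)
  bad-witness {c} c∈C cp@(φ , φ-injective , _ , E) outside
    with counterexample₂ (sedge? c) (λ x y → Graph.adj host x y Bool.≟ true) outside
  ... | x , y , xy∈c , ¬xy with to (E x y) xy∈c
  ... | a , b , refl , refl , ab
    with non-edge⇒non-robust (φ a) (φ b) ¬xy (irreflexive ab ∘ φ-injective)
  ...   | inj₁ ¬robust = blocked-witness c∈C cp a b ab ¬robust
  ...   | inj₂ ¬robust = blocked-witness c∈C cp b a (Graph.sym T a b ab) ¬robust

  size-bound : Unique C → ¬ ContainsFe T H C → ∀ {ex} → (∀ m → ExAdmissible n T H m → m ≤ ex) →
    length C ≤ ex + badCodes n K vT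
  size-bound distinct F^e-free {ex} ex-max = begin
    length C                          ≡⟨ length-filter-split inHost? C ⟩
    length inside + length outside    ≤⟨ ℕ.+-mono-≤ (ex-max _ inside-admissible) outside-few ⟩
    ex + badCodes n K vT              ∎
    where
    open ℕ.≤-Reasoning
    inside outside : List (Sub n)
    inside = filter inHost? C
    outside = filter (¬? ∘ inHost?) C
    inside-admissible : ExAdmissible n T H (length inside)
    inside-admissible =
      host , host-H-free F^e-free , inside ,
      (UniqueP.filter⁺ inHost? distinct , AllP.filter⁺ inHost? copies) , AllP.all-filter inHost? C , refl
    BadCopy : Sub n → Set
    BadCopy c = (c ∈ₗ C × IsCopyOf T c) × ¬ InHost c
    outside-bad : All BadCopy outside
    outside-bad = All.zip
      (AllP.filter⁺ (¬? ∘ inHost?) (All.tabulate (λ c∈C → c∈C , All.lookup copies c∈C)) ,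
       AllP.all-filter (¬? ∘ inHost?) C)
    code : ∀ {c} → BadCopy c → Fin (badCodes n K vT)
    code ((c∈C , cp) , bad) = encode (bad-witness c∈C cp bad)
    outside-few : length outside ≤ badCodes n K vT
    outside-few = length-≤-by-injection code
      (λ ((c∈C , cp) , bad) ((c∈C' , cp') , bad') same →
         copy-determined {T = T} cp cp' (encode-injective (bad-witness c∈C cp bad) (bad-witness c∈C' cp' bad') same))
      (UniqueP.filter⁺ (¬? ∘ inHost?) distinct) outside-bad

lemma3p5 : ∀ {vT vH} (T : Graph vT) (H : Graph vH) →
    ∀ (k : ℕ) → ∃[ N ] ∀ n → N ≤ n → ∀ a b →
    IsEx n T H a → IsExStar n T H b → k * ∣ a - b ∣ ≤ n ^ vT
lemma3p5 {vT} {vH} T H k = k * (vT * (vT * (vT * K))) , bound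
  where
  K : ℕ
  K = blockerSize vT vH
  bound : ∀ n → k * (vT * (vT * (vT * K))) ≤ n → ∀ a b →
    IsEx n T H a → IsExStar n T H b → k * ∣ a - b ∣ ≤ n ^ vT
  bound n large a b (ex , ex-max) ((C , (distinct , copies) , F^e-free , refl) , ex*-max) = begin
    k * ∣ a - b ∣            ≡⟨ cong (k *_) (ℕ.m≤n⇒∣m-n∣≡n∸m a≤b) ⟩
    k * (b ∸ a)              ≤⟨ ℕ.*-monoʳ-≤ k (ℕ.m≤n+o⇒m∸n≤o b a b≤a+bad) ⟩
    k * badCodes n K vT      ≤⟨ badCodes-small n K vT k large ⟩
    n ^ vT                   ∎
    where
    open ℕ.≤-Reasoning
    a≤b : a ≤ b
    a≤b = ex*-max a (ex-admissible⇒ex*-admissible T H ex)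
    b≤a+bad : b ≤ a + badCodes n K vT
    b≤a+bad = HostGraph.size-bound T H C copies distinct F^e-free ex-max
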